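{- Let $F$ be a field of characteristic zero, $f$ an anti-involution of $F^\times$, and $\Phi_f(G)=(G,F^\times,\varphi,f)$ a skew gain graph whose underlying graph $G$ is a tree of order $n$ with matching number $t<\frac{n}{2}$. Then $0$ is an eigenvalue of $A(\Phi_f(G))$ with algebraic multiplicity at least $n-2t$.
   Context: An anti-involution of $F^\times$ is a map $f:F^\times\to F^\times$ with $f(f(x))=x$ and $f(xy)=f(y)f(x)$. A skew gain graph $(G,F^\times,\varphi,f)$ is a simple graph $G$ with vertices $v_1,\dots,v_n$ and a function $\varphi$ on oriented edges (both orientations of each edge) with values in $F^\times$ satisfying $\varphi(\overrightarrow{vu})=f(\varphi(\overrightarrow{uv}))$. Its adjacency matrix $A$ has $(i,j)$ entry $\varphi(\overrightarrow{v_iv_j})$ if $v_i\sim v_j$ and $0$ otherwise. The matching number of $G$ is the maximum number of edges in a matching of $G$. -}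

module Defs where

open import Level using (Level; _⊔_)
open import Algebra.Bundles using (CommutativeRing)
open import Data.Nat as ℕ using (ℕ; zero; suc; _<_; _≤_)
open import Data.Fin as Fin using (Fin; zero; suc; punchIn)
open import Data.Bool using (Bool; true; false; if_then_else_; T)
open import Data.List as List using (List; []; _∷_; length; map; concatMap)
open import Data.List.Relation.Unary.All using (All)
open import Data.List.Relation.Unary.Unique.Propositional using (Unique)
open import Data.Product using (Σ; ∃; _×_; _,_; proj₁; proj₂)
open import Relation.Nullary using (¬_; does)
open import Relation.Binary.PropositionalEquality using (_≡_)

record Field (c ℓ : Level) : Set (Level.suc (c ⊔ ℓ)) where
  field
    commutativeRing : CommutativeRing c ℓ
  open CommutativeRing commutativeRing public
  field
    0≉1     : ¬ (0# ≈ 1#)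
    inverse : ∀ x → ¬ (x ≈ 0#) → ∃ λ y → x * y ≈ 1#

module _ {c ℓ} (F : Field c ℓ) where
  open Field F using (Carrier; _≈_; _+_; _*_; 0#; 1#)

  natToF : ℕ → Carrier
  natToF zero    = 0#
  natToF (suc k) = 1# + natToF k

  CharZero : Set ℓ
  CharZero = ∀ k → ¬ (natToF (suc k) ≈ 0#)

  Units : Set (c ⊔ ℓ)
  Units = Σ Carrier (λ x → ¬ (x ≈ 0#))

  record AntiInvolution : Set (c ⊔ ℓ) where
    field
      f          : Units → Units
      f-cong     : ∀ x y → proj₁ x ≈ proj₁ y → proj₁ (f x) ≈ proj₁ (f y)
      involutive : ∀ x → proj₁ (f (f x)) ≈ proj₁ x
      anti-hom   : ∀ x y (p : ¬ (proj₁ x * proj₁ y ≈ 0#)) →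
                   proj₁ (f (proj₁ x * proj₁ y , p)) ≈ proj₁ (f y) * proj₁ (f x)

-- Polynomials over F as coefficient lists (constant term first),
-- and determinants by Laplace expansion along the first row.

module Poly {c ℓ} (F : Field c ℓ) where
  open Field F using (Carrier; _≈_; _+_; _*_; -_; 0#; 1#)

  Pol : Set c
  Pol = List Carrier

  addP : Pol → Pol → Pol
  addP []       q        = q
  addP (a ∷ p)  []       = a ∷ p
  addP (a ∷ p)  (b ∷ q)  = (a + b) ∷ addP p q

  negP : Pol → Pol
  negP = map (-_)

  subP : Pol → Pol → Pol
  subP p q = addP p (negP q)

  scaleP : Carrier → Pol → Pol
  scaleP a = map (a *_)

  mulP : Pol → Pol → Pol
  mulP []      q = []
  mulP (a ∷ p) q = addP (scaleP a q) (0# ∷ mulP p q)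

  oneP : Pol
  oneP = 1# ∷ []

  zeroP : Pol
  zeroP = []

  coeff : ℕ → Pol → Carrier
  coeff k       []      = 0#
  coeff zero    (a ∷ p) = a
  coeff (suc k) (a ∷ p) = coeff k p

  altSum : ∀ m → (Fin m → Pol) → Pol
  altSum zero    g = zeroP
  altSum (suc m) g = subP (g zero) (altSum m (λ j → g (suc j)))

  det : ∀ m → (Fin m → Fin m → Pol) → Pol
  det zero    M = oneP
  det (suc m) M =
    altSum (suc m) (λ j → mulP (M zero j) (det m (λ r s → M (suc r) (punchIn j s))))

  charPoly : ∀ m → (Fin m → Fin m → Carrier) → Pol
  charPoly m A = det m (λ i j →
    if does (i Fin.≟ j) then (- A i j) ∷ 1# ∷ [] else (- A i j) ∷ [])

  -- 0 is a root of p of multiplicity at least k, i.e. x^k divides p: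
  -- the coefficients of 1, x, ..., x^(k-1) all vanish.
  ZeroRootMultAtLeast : Pol → ℕ → Set ℓ
  ZeroRootMultAtLeast p k = ∀ i → i < k → coeff i p ≈ 0#

record SimpleGraph (n : ℕ) : Set where
  field
    adj    : Fin n → Fin n → Bool
    sym    : ∀ i j → adj i j ≡ adj j i
    irrefl : ∀ i → adj i i ≡ false

module _ {n : ℕ} (G : SimpleGraph n) where
  open SimpleGraph G

  data Walk : Fin n → Fin n → Set where
    nil  : ∀ {u} → Walk u u
    cons : ∀ {u w v} → T (adj u w) → Walk w v → Walk u v

  walkLength : ∀ {u v} → Walk u v → ℕ
  walkLength nil        = zero
  walkLength (cons _ p) = suc (walkLength p)

  walkTail : ∀ {u v} → Walk u v → List (Fin n)
  walkTail nil                 = []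
  walkTail (cons {w = w} _ p)  = w ∷ walkTail p

  Connected : Set
  Connected = ∀ u v → Walk u v

  IsCycle : ∀ {u} → Walk u u → Set
  IsCycle w = (3 ≤ walkLength w) × Unique (walkTail w)

  Acyclic : Set
  Acyclic = ∀ u (w : Walk u u) → ¬ IsCycle w

  IsTree : Set
  IsTree = Connected × Acyclic

  IsMatching : List (Fin n × Fin n) → Set
  IsMatching M = All (λ e → T (adj (proj₁ e) (proj₂ e))) M
               × Unique (concatMap (λ e → proj₁ e ∷ proj₂ e ∷ []) M)

  IsMatchingNumber : ℕ → Set
  IsMatchingNumber t =
    (Σ (List (Fin n × Fin n)) λ M → IsMatching M × length M ≡ t)
    × (∀ M → IsMatching M → length M ≤ t)

module _ {c ℓ} (F : Field c ℓ) (f : AntiInvolution F) {n : ℕ} (G : SimpleGraph n) where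
  open Field F using (Carrier; _≈_; 0#)
  open AntiInvolution f renaming (f to fᵤ)
  open SimpleGraph G

  -- φ gives a gain φ(v_i v_j) ∈ F^× to every oriented edge (values on
  -- non-edges are irrelevant), with φ(v_j v_i) = f(φ(v_i v_j)).
  IsSkewGain : (Fin n → Fin n → Units F) → Set ℓ
  IsSkewGain φ = ∀ i j → T (adj i j) → proj₁ (φ j i) ≈ proj₁ (fᵤ (φ i j))

  adjMatrix : (Fin n → Fin n → Units F) → Fin n → Fin n → Carrier
  adjMatrix φ i j = if adj i j then proj₁ (φ i j) else 0#

-- Expand det (x I − A) along first rows: each term picks a permutation σ and is a product of
-- entries (x I − A) r (σ r).  A diagonal entry is divisible by x (A has zero diagonal) and an
-- off-diagonal entry vanishes unless r and σ r are adjacent.  So only permutations moving every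
-- vertex to a neighbour contribute, and in a forest such a permutation is an involution: an orbit
-- of length at least 3 would be a cycle.  Its 2-cycles then form a matching, so σ has at least
-- n − 2t fixed points and the term is divisible by x^(n − 2t).

module Submission where

open import Defs
import Algebra.Properties.Ring
open import Data.Bool using (true; false; T; if_then_else_)
import Data.Bool.Properties as Bool
open import Data.Empty using (⊥-elim)
open import Data.Fin as Fin using (Fin; zero; suc; punchIn; toℕ)
import Data.Fin.Properties as Fin
open import Data.List using (List; []; _∷_; length; map; filter; tabulate; allFin; applyUpTo)
import Data.List.Properties as List
open import Data.List.Relation.Unary.All as All using (All; []; _∷_)
import Data.List.Relation.Unary.All.Properties as All
open import Data.List.Relation.Unary.AllPairs as AllPairs using (AllPairs; []; _∷_)
import Data.List.Relation.Unary.AllPairs.Properties as AllPairs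
open import Data.List.Relation.Unary.Unique.Propositional using (Unique)
import Data.List.Relation.Unary.Unique.Propositional.Properties as Unique
open import Data.Nat as ℕ using (ℕ; zero; suc; _+_; _*_; _∸_; _≤_; _<_; z≤n; s≤s)
import Data.Nat.Properties as ℕ
open import Algebra.Properties.CommutativeMonoid.Sum ℕ.+-0-commutativeMonoid
  using (sum; sum-syntax; ∑-distrib-+; sum-remove)
open import Data.Nat.GeneralisedArithmetic using (iterate)
open import Data.Nat.Induction using (<-rec)
open import Data.Product using (_×_; _,_; ∃)
open import Data.Unit using (⊤; tt)
open import Function using (_∘_; flip)
open import Function.Definitions using (Injective)
open import Relation.Binary using (Rel; Asymmetric; Decidable; tri<; tri≈; tri>)
open import Relation.Binary.PropositionalEquality as ≡ using (_≡_; _≢_; refl)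
open import Relation.Nullary using (¬_; Dec; yes; no; does; ¬?; _×-dec_)
open import Relation.Unary as U using (Pred)

least-witness : ∀ {p} {P : Pred ℕ p} → U.Decidable P → ∀ d → P d →
                ∃ λ m → P m × (∀ {e} → e < m → ¬ P e)
least-witness {P = P} P? = <-rec _ step
  where
    step : ∀ d → (∀ {e} → e < d → P e → ∃ λ m → P m × (∀ {e} → e < m → ¬ P e)) →
           P d → ∃ λ m → P m × (∀ {e} → e < m → ¬ P e)
    step d smaller Pd with ℕ.anyUpTo? P? d
    ... | yes (e , e<d , Pe) = smaller e<d Pe
    ... | no ∄e              = d , Pd , λ e<d Pe → ∄e (_ , e<d , Pe)

∑-1 : ∀ n → ∑[ r < n ] 1 ≡ n
∑-1 zero    = refl
∑-1 (suc n) = ≡.cong suc (∑-1 n)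

∑-mono-≤ : ∀ {n} {f g : Fin n → ℕ} → (∀ r → f r ≤ g r) → sum f ≤ sum g
∑-mono-≤ {zero}  f≤g = z≤n
∑-mono-≤ {suc n} f≤g = ℕ.+-mono-≤ (f≤g zero) (∑-mono-≤ (f≤g ∘ suc))

≤-∑ : ∀ {n} (f : Fin n → ℕ) r → f r ≤ sum f
≤-∑ {suc n} f r = ℕ.≤-trans (ℕ.m≤m+n (f r) _) (ℕ.≤-reflexive (≡.sym (sum-remove {i = r} f)))

indicator : ∀ {p} {P : Set p} → Dec P → ℕ
indicator P? = if does P? then 1 else 0

1≤indicator : ∀ {p} {P : Set p} (P? : Dec P) → P → 1 ≤ indicator P?
1≤indicator (yes _) _  = ℕ.≤-refl
1≤indicator (no ¬p) p = ⊥-elim (¬p p)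

length-filter-tabulate : ∀ {a p n} {A : Set a} {P : Pred A p} (P? : U.Decidable P) (f : Fin n → A) →
                         length (filter P? (tabulate f)) ≡ ∑[ r < n ] indicator (P? (f r))
length-filter-tabulate {n = zero}  P? f = refl
length-filter-tabulate {n = suc n} P? f with does (P? (f zero))
... | true  = ≡.cong suc (length-filter-tabulate P? (f ∘ suc))
... | false = length-filter-tabulate P? (f ∘ suc)

AllPairs-discharge : ∀ {a p r} {A : Set a} {P : Pred A p} {R : Rel A r} {xs} → All P xs →
                     AllPairs (λ x y → P x → P y → R x y) xs → AllPairs R xs
AllPairs-discharge []         []         = []
AllPairs-discharge (px ∷ pxs) (rx ∷ rxs) =
  All.zipWith (λ (r , py) → r px py) (rx , pxs) ∷ AllPairs-discharge pxs rxs

module _ {a} {A : Set a} {f : A → A} where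

  iterate-commute : ∀ x k → f (iterate f x k) ≡ iterate f (f x) k
  iterate-commute x zero    = refl
  iterate-commute x (suc k) = iterate-commute (f x) k

  iterate-+ : ∀ x i j → iterate f x (i + j) ≡ iterate f (iterate f x i) j
  iterate-+ x zero    j = refl
  iterate-+ x (suc i) j = iterate-+ (f x) i j

  module _ (f-injective : Injective _≡_ _≡_ f) where

    iterate-injective : ∀ k {x y} → iterate f x k ≡ iterate f y k → x ≡ y
    iterate-injective zero    e = e
    iterate-injective (suc k) e = f-injective (iterate-injective k e)

    iterate-period : ∀ x i d → iterate f x (i + d) ≡ iterate f x i → iterate f x d ≡ x
    iterate-period x i d e = iterate-injective i (begin
      iterate f (iterate f x d) i ≡⟨ ≡.sym (iterate-+ x d i) ⟩
      iterate f x (d + i)         ≡⟨ ≡.cong (iterate f x) (ℕ.+-comm d i) ⟩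
      iterate f x (i + d)         ≡⟨ e ⟩
      iterate f x i               ∎)
      where open ≡.≡-Reasoning

module _ {n} (G : SimpleGraph n) where
  open SimpleGraph G using (adj)

  orbitWalk : ∀ {g : Fin n → Fin n} k {x v} → iterate g x k ≡ v →
              (∀ i → T (adj (iterate g x i) (iterate g x (suc i)))) → Walk G x v
  orbitWalk zero    refl steps = nil
  orbitWalk (suc k) ends steps = cons (steps 0) (orbitWalk k ends (steps ∘ suc))

  walkLength-orbitWalk : ∀ {g : Fin n → Fin n} k {x v} (ends : iterate g x k ≡ v) steps →
                         walkLength G (orbitWalk k ends steps) ≡ k
  walkLength-orbitWalk zero    refl steps = refl
  walkLength-orbitWalk (suc k) ends steps = ≡.cong suc (walkLength-orbitWalk k ends (steps ∘ suc))

  walkTail-orbitWalk : ∀ {g : Fin n → Fin n} k {x v} (ends : iterate g x k ≡ v) steps →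
                       walkTail G (orbitWalk k ends steps) ≡ applyUpTo (λ i → iterate g x (suc i)) k
  walkTail-orbitWalk zero    refl steps = refl
  walkTail-orbitWalk (suc k) ends steps = ≡.cong (_ ∷_) (walkTail-orbitWalk k ends (steps ∘ suc))

module _ {n} (G : SimpleGraph n) {σ : Fin n → Fin n} (σ-injective : Injective _≡_ _≡_ σ)
         (σ-involutive : ∀ r → σ (σ r) ≡ r)
         (σ-adj : ∀ r → σ r ≢ r → T (SimpleGraph.adj G r (σ r)))
         {ℓ} {R : Rel (Fin n) ℓ} (R-asym : Asymmetric R) (R? : Decidable R) where

  orientedEdges : List (Fin n × Fin n)
  orientedEdges = map (λ r → r , σ r) (filter (λ r → R? r (σ r)) (allFin n))

  length-orientedEdges : length orientedEdges ≡ ∑[ r < n ] indicator (R? r (σ r))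
  length-orientedEdges =
    ≡.trans (List.length-map _ (filter (λ r → R? r (σ r)) (allFin n)))
            (length-filter-tabulate (λ r → R? r (σ r)) (λ r → r))

  orientedEdges-isMatching : IsMatching G orientedEdges
  orientedEdges-isMatching =
    All.map⁺ (All.map (λ Rr → σ-adj _ (σr≢r Rr)) oriented) ,
    AllPairs.concat⁺
      (All.map⁺ (All.map⁺ (All.map (λ Rr → (σr≢r Rr ∘ ≡.sym ∷ []) ∷ [] ∷ []) oriented)))
      (AllPairs.map⁺ (AllPairs.map⁺ (AllPairs-discharge oriented
        (AllPairs.filter⁺ _ (AllPairs.map disjoint (Unique.allFin⁺ n))))))
    where
      oriented : All (λ r → R r (σ r)) (filter (λ r → R? r (σ r)) (allFin n))
      oriented = All.all-filter _ (allFin n)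
      σr≢r : ∀ {r} → R r (σ r) → σ r ≢ r
      σr≢r {r} Rr σr≡r = R-asym Rrr Rrr
        where Rrr = ≡.subst (R r) σr≡r Rr
      disjoint : ∀ {r r′} → r ≢ r′ → R r (σ r) → R r′ (σ r′) →
                 All (λ x → All (x ≢_) (r′ ∷ σ r′ ∷ [])) (r ∷ σ r ∷ [])
      disjoint {r} {r′} r≢r′ Rr Rr′ =
        (r≢r′ ∷ r≢σr′ ∷ []) ∷ (σr≢r′ ∷ r≢r′ ∘ σ-injective ∷ []) ∷ []
        where
          r≢σr′ : r ≢ σ r′
          r≢σr′ refl = R-asym Rr′ (≡.subst (R (σ r′)) (σ-involutive r′) Rr)
          σr≢r′ : σ r ≢ r′
          σr≢r′ refl = R-asym Rr (≡.subst (R (σ r)) (σ-involutive r) Rr′)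

fixedPointCount : ∀ {n} → (Fin n → Fin n) → ℕ
fixedPointCount {n} σ = ∑[ r < n ] indicator (r Fin.≟ σ r)

module _ {n} {G : SimpleGraph n} (acyclic : Acyclic G) {σ : Fin n → Fin n}
         (σ-injective : Injective _≡_ _≡_ σ)
         (σ-adj : ∀ r → σ r ≢ r → T (SimpleGraph.adj G r (σ r))) where

  periodic : ∀ x → ∃ λ d → iterate σ x (suc d) ≡ x
  periodic x with i , j , i<j , same ← Fin.pigeonhole (ℕ.n<1+n n) (iterate σ x ∘ toℕ)
              with d , i+1+d≡j ← ℕ.m≤n⇒∃[o]m+o≡n i<j
    = d , iterate-period σ-injective x (toℕ i) (suc d)
            (≡.trans (≡.cong (iterate σ x) (≡.trans (ℕ.+-suc (toℕ i) d) i+1+d≡j)) (≡.sym same))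

  σ-involutive : ∀ r → σ (σ r) ≡ r
  σ-involutive r with σ r Fin.≟ r | periodic r
  ... | yes σr≡r | _ = ≡.trans (≡.cong σ σr≡r) σr≡r
  ... | no σr≢r | d , returns
        with least-witness (λ e → iterate σ r (suc e) Fin.≟ r) d returns
  ... | zero        , σr≡r  , _        = ⊥-elim (σr≢r σr≡r)
  ... | suc zero    , σσr≡r , _        = σσr≡r
  ... | suc (suc k) , closes , shortest =
    ⊥-elim (acyclic r cycle (long , Unique-tail))
    where
      steps : ∀ i → T (SimpleGraph.adj G (iterate σ r i) (iterate σ r (suc i)))
      steps i = ≡.subst (T ∘ SimpleGraph.adj G (iterate σ r i)) (iterate-commute r i)
                  (σ-adj _ λ e → σr≢r (iterate-injective σ-injective i
                                        (≡.trans (≡.sym (iterate-commute r i)) e)))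
      cycle : Walk G r r
      cycle = orbitWalk G (3 + k) closes steps
      long : 3 ≤ walkLength G cycle
      long = ≡.subst (3 ≤_) (≡.sym (walkLength-orbitWalk G (3 + k) closes steps)) (ℕ.m≤m+n 3 k)
      distinct : ∀ {i j} → i < j → j < 3 + k → iterate σ r (suc i) ≢ iterate σ r (suc j)
      distinct {i} {j} i<j j<3+k same with d , i+1+d≡j ← ℕ.m≤n⇒∃[o]m+o≡n i<j =
        shortest (ℕ.<-≤-trans (≡.subst (d <_) i+1+d≡j (ℕ.m<n+m d ℕ.z<s)) (ℕ.s≤s⁻¹ j<3+k))
          (iterate-period σ-injective r (suc i) (suc d)
            (≡.trans (≡.cong (iterate σ r) (≡.cong suc (≡.trans (ℕ.+-suc i d) i+1+d≡j)))
                     (≡.sym same)))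
      Unique-tail : Unique (walkTail G cycle)
      Unique-tail = ≡.subst Unique (≡.sym (walkTail-orbitWalk G (3 + k) closes steps))
                      (Unique.applyUpTo⁺₁ _ (3 + k) distinct)

  fixedPointCount-≥ : ∀ {t} → IsMatchingNumber G t → n ∸ 2 * t ≤ fixedPointCount σ
  fixedPointCount-≥ {t} (_ , maximum) = ℕ.m≤n+o⇒m∸n≤o n (2 * t) (begin
    n                                       ≡⟨ ≡.sym (∑-1 n) ⟩
    ∑[ r < n ] 1                            ≤⟨ ∑-mono-≤ covered ⟩
    ∑[ r < n ] ((up r + down r) + fix r)    ≡⟨ ∑-distrib-+ (λ r → up r + down r) fix ⟩
    ∑[ r < n ] (up r + down r) + sum fix    ≡⟨ ≡.cong (_+ sum fix) (∑-distrib-+ up down) ⟩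
    (sum up + sum down) + sum fix           ≤⟨ ℕ.+-monoˡ-≤ (sum fix) (ℕ.+-mono-≤
                                                 (matched Fin._<_ Fin.<-asym Fin._<?_)
                                                 (ℕ.m≤n⇒m≤n+o 0 (matched (flip Fin._<_) Fin.<-asym
                                                                         (flip Fin._<?_)))) ⟩
    2 * t + sum fix                         ∎)
    where
      open ℕ.≤-Reasoning
      up down fix : Fin n → ℕ
      up   r = indicator (r Fin.<? σ r)
      down r = indicator (σ r Fin.<? r)
      fix  r = indicator (r Fin.≟ σ r)
      covered : ∀ r → 1 ≤ (up r + down r) + fix r
      covered r with Fin.<-cmp r (σ r)
      ... | tri< r<σr _ _ = ℕ.≤-trans (1≤indicator (r Fin.<? σ r) r<σr)
                              (ℕ.≤-trans (ℕ.m≤m+n (up r) _) (ℕ.m≤m+n _ (fix r)))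
      ... | tri> _ _ σr<r = ℕ.≤-trans (1≤indicator (σ r Fin.<? r) σr<r)
                              (ℕ.≤-trans (ℕ.m≤n+m (down r) _) (ℕ.m≤m+n _ (fix r)))
      ... | tri≈ _ r≡σr _ = ℕ.≤-trans (1≤indicator (r Fin.≟ σ r) r≡σr) (ℕ.m≤n+m (fix r) _)
      -- Each 2-cycle of σ is counted once with R = _<_ and once with R = flip _<_.
      matched : ∀ {ℓ} (R : Rel (Fin n) ℓ) → Asymmetric R → (R? : Decidable R) →
                ∑[ r < n ] indicator (R? r (σ r)) ≤ t
      matched R R-asym R? =
        ≡.subst (_≤ t) (length-orientedEdges G σ-injective σ-involutive σ-adj R-asym R?)
          (maximum _ (orientedEdges-isMatching G σ-injective σ-involutive σ-adj R-asym R?))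

-- A term of the Laplace expansion of det along first rows: the column taken in the first row,
-- then a term for the complementary minor.  column p is the permutation the term runs through.
LaplacePath : ℕ → Set
LaplacePath zero    = ⊤
LaplacePath (suc m) = Fin (suc m) × LaplacePath m

column : ∀ {m} → LaplacePath m → Fin m → Fin m
column (j , p) zero    = j
column (j , p) (suc r) = punchIn j (column p r)

column-injective : ∀ {m} (p : LaplacePath m) → Injective _≡_ _≡_ (column p)
column-injective (j , p) {zero}  {zero}  _ = refl
column-injective (j , p) {zero}  {suc s} e = ⊥-elim (Fin.punchInᵢ≢i j _ (≡.sym e))
column-injective (j , p) {suc r} {zero}  e = ⊥-elim (Fin.punchInᵢ≢i j _ e)
column-injective (j , p) {suc r} {suc s} e =
  ≡.cong suc (column-injective p (Fin.punchIn-injective j _ _ e))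

module _ {c ℓ} (F : Field c ℓ) where
  private module 𝔽 = Field F
  open 𝔽 using (Carrier; _≈_; 0#; 1#; -_; sym; trans; +-cong; -‿cong; *-congˡ; *-congʳ;
               +-identityˡ; +-identityʳ; zeroˡ; zeroʳ)
  open Algebra.Properties.Ring 𝔽.ring using (-0#≈0#)
  open Poly F

  X^_∣_ : ℕ → Pol → Set ℓ
  X^ k ∣ p = ZeroRootMultAtLeast p k

  coeff-addP : ∀ i p q → coeff i (addP p q) ≈ coeff i p 𝔽.+ coeff i q
  coeff-addP i       []      q       = sym (+-identityˡ _)
  coeff-addP zero    (a ∷ p) []      = sym (+-identityʳ _)
  coeff-addP (suc i) (a ∷ p) []      = sym (+-identityʳ _)
  coeff-addP zero    (a ∷ p) (b ∷ q) = 𝔽.refl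
  coeff-addP (suc i) (a ∷ p) (b ∷ q) = coeff-addP i p q

  coeff-negP : ∀ i p → coeff i (negP p) ≈ - coeff i p
  coeff-negP i       []      = sym -0#≈0#
  coeff-negP zero    (a ∷ p) = 𝔽.refl
  coeff-negP (suc i) (a ∷ p) = coeff-negP i p

  coeff-scaleP : ∀ i a p → coeff i (scaleP a p) ≈ a 𝔽.* coeff i p
  coeff-scaleP i       a []      = sym (zeroʳ a)
  coeff-scaleP zero    a (b ∷ p) = 𝔽.refl
  coeff-scaleP (suc i) a (b ∷ p) = coeff-scaleP i a p

  X^0∣ : ∀ p → X^ 0 ∣ p
  X^0∣ p i ()

  X^∣-mono : ∀ {a b} p → b ≤ a → X^ a ∣ p → X^ b ∣ p
  X^∣-mono p b≤a a∣p i i<b = a∣p i (ℕ.<-≤-trans i<b b≤a)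

  X^∣-addP : ∀ {k} p q → X^ k ∣ p → X^ k ∣ q → X^ k ∣ addP p q
  X^∣-addP p q k∣p k∣q i i<k =
    trans (coeff-addP i p q) (trans (+-cong (k∣p i i<k) (k∣q i i<k)) (+-identityˡ 0#))

  X^∣-subP : ∀ {k} p q → X^ k ∣ p → X^ k ∣ q → X^ k ∣ subP p q
  X^∣-subP p q k∣p k∣q = X^∣-addP p (negP q) k∣p λ i i<k →
    trans (coeff-negP i q) (trans (-‿cong (k∣q i i<k)) -0#≈0#)

  X^∣-scaleP : ∀ {k} a p → X^ k ∣ p → X^ k ∣ scaleP a p
  X^∣-scaleP a p k∣p i i<k = trans (coeff-scaleP i a p) (trans (*-congˡ (k∣p i i<k)) (zeroʳ a))

  X^∣-scaleP-0# : ∀ {k a} p → a ≈ 0# → X^ k ∣ scaleP a p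
  X^∣-scaleP-0# {a = a} p a≈0 i _ = trans (coeff-scaleP i a p) (trans (*-congʳ a≈0) (zeroˡ _))

  X^suc∣0#∷ : ∀ {k} p → X^ k ∣ p → X^ suc k ∣ (0# ∷ p)
  X^suc∣0#∷ p k∣p zero    _         = 𝔽.refl
  X^suc∣0#∷ p k∣p (suc i) (s≤s i<k) = k∣p i i<k

  X^∣-mulPʳ : ∀ {k} p q → X^ k ∣ q → X^ k ∣ mulP p q
  X^∣-mulPʳ []      q k∣q i _ = 𝔽.refl
  X^∣-mulPʳ (a ∷ p) q k∣q = X^∣-addP (scaleP a q) (0# ∷ mulP p q) (X^∣-scaleP a q k∣q)
    (X^∣-mono (0# ∷ mulP p q) (ℕ.n≤1+n _) (X^suc∣0#∷ (mulP p q) (X^∣-mulPʳ p q k∣q)))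

  X^∣-mulP : ∀ {a b} p q → X^ a ∣ p → X^ b ∣ q → X^ (a + b) ∣ mulP p q
  X^∣-mulP {zero}  p       q a∣p b∣q = X^∣-mulPʳ p q b∣q
  X^∣-mulP {suc a} []      q a∣p b∣q i _ = 𝔽.refl
  X^∣-mulP {suc a} (c ∷ p) q a∣p b∣q = X^∣-addP (scaleP c q) (0# ∷ mulP p q)
    (X^∣-scaleP-0# q (a∣p 0 (s≤s z≤n)))
    (X^suc∣0#∷ (mulP p q) (X^∣-mulP p q (λ i i<a → a∣p (suc i) (s≤s i<a)) b∣q))

  X^∣-altSum : ∀ {k} m g → (∀ j → X^ k ∣ g j) → X^ k ∣ altSum m g
  X^∣-altSum zero    g k∣g i _ = 𝔽.refl
  X^∣-altSum (suc m) g k∣g =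
    X^∣-subP (g zero) (altSum m (g ∘ suc)) (k∣g zero) (X^∣-altSum m (g ∘ suc) (k∣g ∘ suc))

  X^∣-det : ∀ m M (w : Fin m → Fin m → ℕ) {k} → (∀ r s → X^ w r s ∣ M r s) →
            (∀ p → k ≤ ∑[ r < m ] w r (column p r)) → X^ k ∣ det m M
  X^∣-det zero    M w {k} M∣ k≤ with k≤ tt
  ... | z≤n = X^0∣ oneP
  X^∣-det (suc m) M w {k} M∣ k≤ = X^∣-altSum (suc m) (λ j → mulP (M zero j) (det m (minor j))) λ j →
    X^∣-mono (mulP (M zero j) (det m (minor j))) (ℕ.m≤n+m∸n k (w zero j))
      (X^∣-mulP (M zero j) (det m (minor j)) (M∣ zero j)
        (X^∣-det m (minor j) (λ r s → w (suc r) (punchIn j s)) (λ r s → M∣ (suc r) (punchIn j s))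
          λ p → ℕ.≤-trans (ℕ.∸-monoˡ-≤ (w zero j) (k≤ (j , p)))
                          (ℕ.≤-reflexive (ℕ.m+n∸m≡n (w zero j) _))))
    where
      minor : Fin (suc m) → Fin m → Fin m → Pol
      minor j r s = M (suc r) (punchIn j s)

  X^∣-charPoly-forest : ∀ {n} {G : SimpleGraph n} → Acyclic G → ∀ {t} → IsMatchingNumber G t →
                        (A : Fin n → Fin n → Carrier) →
                        (∀ i j → SimpleGraph.adj G i j ≡ false → A i j ≈ 0#) →
                        X^ (n ∸ 2 * t) ∣ charPoly n A
  X^∣-charPoly-forest {n} {G} acyclic {t} t-matching A A-support =
    X^∣-det n _ weight entry-divisible path-weight
    where
      open SimpleGraph G using (adj; irrefl)

      -- Off-diagonal entries at non-edges are constant zero polynomials; n stands in for ∞.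
      weight : Fin n → Fin n → ℕ
      weight i j = if does (i Fin.≟ j) then 1 else if adj i j then 0 else n

      neg-A≈0 : ∀ i j → adj i j ≡ false → - A i j ≈ 0#
      neg-A≈0 i j nonadj = trans (-‿cong (A-support i j nonadj)) -0#≈0#

      entry-divisible : ∀ i j → X^ weight i j ∣
                          (if does (i Fin.≟ j) then (- A i j) ∷ 1# ∷ [] else (- A i j) ∷ [])
      entry-divisible i j with i Fin.≟ j | adj i j in i~j
      ... | yes refl | _     = λ { zero _ → neg-A≈0 i i (irrefl i) ; (suc k) (s≤s ()) }
      ... | no _     | true  = X^0∣ ((- A i j) ∷ [])
      ... | no _     | false = λ { zero _ → neg-A≈0 i j i~j ; (suc k) _ → 𝔽.refl }

      path-weight : ∀ p → n ∸ 2 * t ≤ ∑[ r < n ] weight r (column p r)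
      path-weight p
        with Fin.any? (λ r → ¬? (r Fin.≟ column p r) ×-dec (adj r (column p r) Bool.≟ false))
      ... | yes (r , moved , nonadj) = ℕ.≤-trans (ℕ.m∸n≤m n (2 * t))
            (ℕ.≤-trans (ℕ.≤-reflexive (≡.sym weight≡n)) (≤-∑ (λ r → weight r (column p r)) r))
        where
          weight≡n : weight r (column p r) ≡ n
          weight≡n with r Fin.≟ column p r
          ... | yes fixed = ⊥-elim (moved fixed)
          ... | no _ rewrite nonadj = refl
      ... | no alongEdges = ℕ.≤-trans
            (fixedPointCount-≥ acyclic (column-injective p) σ-adj t-matching)
            (∑-mono-≤ fixed≤weight)
        where
          σ = column p
          σ-adj : ∀ r → σ r ≢ r → T (adj r (σ r))
          σ-adj r moved with adj r (σ r) in r~σr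
          ... | true  = tt
          ... | false = ⊥-elim (alongEdges (r , moved ∘ ≡.sym , r~σr))
          fixed≤weight : ∀ r → indicator (r Fin.≟ σ r) ≤ weight r (σ r)
          fixed≤weight r with r Fin.≟ σ r
          ... | yes _ = ℕ.≤-refl
          ... | no _  = z≤n

theorem3p7 : ∀ {c ℓ} (F : Field c ℓ) → CharZero F → (f : AntiInvolution F) →
    (n : ℕ) (G : SimpleGraph n) → IsTree G →
    (t : ℕ) → IsMatchingNumber G t → 2 * t < n →
    (φ : Fin n → Fin n → Units F) → IsSkewGain F f G φ →
    Poly.ZeroRootMultAtLeast F (Poly.charPoly F n (adjMatrix F f G φ)) (n ∸ 2 * t)
theorem3p7 F _ f n G (_ , acyclic) t t-matching _ φ _ =
  X^∣-charPoly-forest F acyclic t-matching (adjMatrix F f G φ) adjMatrix-support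
  where
    adjMatrix-support : ∀ i j → SimpleGraph.adj G i j ≡ false →
                        Field._≈_ F (adjMatrix F f G φ i j) (Field.0# F)
    adjMatrix-support i j nonadj rewrite nonadj = Field.refl F
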